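{- Let $L$ be the quantitative language defined by a deterministic $\mathsf{LimAvg}$-automaton over infinite words. If $\eta$ is an isolated cut-point of $L$, then the cut-point language $L^{\geq\eta}$ is $\omega$-regular.
   Context: A weighted automaton is $A=(Q,q_I,\Sigma,\delta,\gamma)$ with finite state set $Q$, initial state $q_I$, finite alphabet $\Sigma$, total transition relation $\delta\subseteq Q\times\Sigma\times Q$, and weights $\gamma:\delta\to\mathbb{Q}$; it is deterministic if for all $q,\sigma$ there is exactly one $q'$ with $(q,\sigma,q')\in\delta$. The run over $w=\sigma_1\sigma_2\dots\in\Sigma^\omega$ is $q_0\sigma_1q_1\dots$ with $q_0=q_I$, $(q_i,\sigma_{i+1},q_{i+1})\in\delta$, and weight sequence $v_i=\gamma(q_i,\sigma_{i+1},q_{i+1})$. As a $\mathsf{LimAvg}$-automaton it defines $L_A(w)=\liminf_{n\to\infty}\frac1n\sum_{i=0}^{n-1}v_i$ (supremum over runs, which is the unique run here). The cut-point language is $L^{\geq\eta}=\{w\mid L(w)\ge\eta\}$. $\eta$ is an isolated cut-point of $L$ if there is $\epsilon>0$ with $|L(w)-\eta|>\epsilon$ for all $w\in\Sigma^\omega$. $\omega$-regular means accepted by a nondeterministic Büchi automaton.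
   Formalization: The cut-point η ranges over ℚ instead of ℝ, and the margin ε in the isolation condition is rational. -}

module Defs where

open import Data.Nat using (ℕ; zero; suc)
import Data.Nat as ℕ
open import Data.Integer using (+_)
open import Data.Fin using (Fin)
open import Data.Bool using (Bool; true)
open import Data.Product using (Σ; ∃; ∃-syntax; _×_; _,_)
open import Data.Sum using (_⊎_)
open import Data.Rational using (ℚ; 0ℚ; _+_; _-_; _*_; _/_; _≤_; _>_)
open import Relation.Binary.PropositionalEquality using (_≡_)

Word : ℕ → Set
Word m = ℕ → Fin m

-- Determinism + totality: the transition relation is the graph of δ,
-- and the weight of the transition (q, σ, δ q σ) is γ q σ.
record DetWA (n m : ℕ) : Set where
  field
    qI : Fin n
    δ  : Fin n → Fin m → Fin n
    γ  : Fin n → Fin m → ℚ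

module _ {n m : ℕ} (A : DetWA n m) where
  open DetWA A

  run : Word m → ℕ → Fin n
  run w zero    = qI
  run w (suc i) = δ (run w i) (w i)

  -- weight sequence v_i = γ(q_i, σ_{i+1}, q_{i+1})
  weight : Word m → ℕ → ℚ
  weight w i = γ (run w i) (w i)

  psum : Word m → ℕ → ℚ
  psum w zero    = 0ℚ
  psum w (suc k) = psum w k + weight w k

  -- the average (1/k) Σ_{i<k} v_i for k = suc j ≥ 1
  avg : Word m → ℕ → ℚ
  avg w j = (+ 1 / suc j) * psum w (suc j)

  -- Comparisons of L_A(w) = liminf_k avg with a rational c
  -- (the liminf is a real number; these are the standard characterisations
  --  of liminf ≥ c, liminf > c and liminf < c).
  LimAvg≥ : Word m → ℚ → Set
  LimAvg≥ w c = ∀ (d : ℚ) → d > 0ℚ → ∃[ N ] ∀ j → N ℕ.≤ j → c - d ≤ avg w j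

  LimAvg> : Word m → ℚ → Set
  LimAvg> w c = ∃[ d ] (d > 0ℚ × ∃[ N ] ∀ j → N ℕ.≤ j → c + d ≤ avg w j)

  LimAvg< : Word m → ℚ → Set
  LimAvg< w c = ∃[ d ] (d > 0ℚ × ∀ N → ∃[ j ] (N ℕ.≤ j × avg w j ≤ c - d))

  -- η is an isolated cut-point: ∃ ε > 0. ∀ w. |L(w) - η| > ε
  IsolatedCutPoint : ℚ → Set
  IsolatedCutPoint η =
    ∃[ ε ] (ε > 0ℚ × ∀ (w : Word m) → LimAvg> w (η + ε) ⊎ LimAvg< w (η - ε))

  CutPointLang : ℚ → Word m → Set
  CutPointLang η w = LimAvg≥ w η

record NBA (m : ℕ) : Set where
  field
    k     : ℕ
    init  : Fin k
    Δ     : Fin k → Fin m → Fin k → Bool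
    acc   : Fin k → Bool

module _ {m : ℕ} (B : NBA m) where
  open NBA B

  IsRun : Word m → (ℕ → Fin k) → Set
  IsRun w r = (r 0 ≡ init) × (∀ i → Δ (r i) (w i) (r (suc i)) ≡ true)

  Accepts : Word m → Set
  Accepts w = ∃[ r ] (IsRun w r × ∀ i → ∃[ j ] (i ℕ.≤ j × acc (r j) ≡ true))

OmegaRegular : {m : ℕ} → (Word m → Set) → Set
OmegaRegular {m} L =
  ∃[ B ] ∀ (w : Word m) → (L w → Accepts {m} B w) × (Accepts B w → L w)

-- Let ε witness isolation and shift all weights by η - ε. Then on every word the
-- averages either eventually stay above g = 2ε or infinitely often fall below 0, and
-- L(w) ≥ η holds iff the former happens. Realising a cycle of A as a lasso word v u u u …
-- shows that every cycle at a reachable state has average > g or negative weight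
-- (cycle-dichotomy), and a pumping argument on c^a W^b shows that both kinds cannot occur
-- at the same state (no-mixed-cycles). Call a state good if it has a cycle of length ≤ n
-- and non-negative weight; the Büchi automaton is the transition graph of A accepting in
-- good states. If the averages stay above g, good states recur, since by cycle removal a
-- path avoiding them has weight ≤ B·n (avoiding-good-bound). If a good state recurs, every
-- cycle through it has non-negative weight, which keeps the averages from falling below 0.
module Submission where

open import Defs
open import Data.Nat using (ℕ)
open import Data.Rational using (ℚ)

import Data.Nat as ℕ
import Data.Nat.Properties as ℕP

import Data.Integer as ℤ
open import Agda.Builtin.Int using (pos; negsuc)
import Data.Integer.Properties as ℤP
open import Data.Nat.Coprimality using (1-coprimeTo)
import Data.Nat.Coprimality as Coprimality
open import Data.Rational using (mkℚ; 0ℚ; 1ℚ; _+_; _-_; _*_; _/_; _≤_; _<_; -_; 1/_; ∣_∣; _⊔_)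
open import Data.Fin using (Fin)
import Data.Fin as Fin
import Data.Fin.Properties as FinP
open import Data.List using (List; []; _∷_; _++_; length; take; drop; lookup)
open import Data.Nat.DivMod using (_%_; m%n<n; [m+kn]%n≡m%n; m<n⇒m%n≡m)
import Data.Nat.DivMod as DivMod
import Data.List.Properties as LP
open import Data.List.Relation.Unary.All using (All; []; _∷_)
import Data.List.Relation.Unary.All.Properties as AllP
open import Induction.WellFounded using (Acc; acc)
open import Data.Nat.Induction using (<-wellFounded)
import Data.Rational as ℚ
import Data.Rational.Properties as ℚP
import Data.Rational.Unnormalised as ℚᵘ
import Data.Rational.Unnormalised.Properties as ℚᵘP
import Data.Integer.Solver
module ZS = Data.Integer.Solver.+-*-Solver
open import Data.Rational.Solver using (module +-*-Solver)
open +-*-Solver using (solve; _:=_; _:+_; _:*_; :-_; _:-_; con)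
open import Data.Product using (∃-syntax; _×_; _,_; proj₁; proj₂)
open import Data.Sum using (_⊎_; inj₁; inj₂; [_,_]′)
import Data.Sum as Sum
open import Data.Empty using (⊥; ⊥-elim)
open import Relation.Nullary using (¬_; Dec; yes; no; does)
open import Relation.Nullary.Decidable using (_×-dec_; dec-true)
open import Data.Bool using (true)
open import Function using (_∘_)
open import Relation.Binary.PropositionalEquality using (_≡_; refl; sym; trans; cong; cong₂; subst; subst₂; module ≡-Reasoning)

-- The embedding ℕ → ℚ, defined by recursion so that ι (suc k) = 1 + ι k holds by definition.
-- It preserves + and *, is non-negative and monotone.
ι : ℕ → ℚ
ι ℕ.zero    = 0ℚ
ι (ℕ.suc k) = 1ℚ + ι k

ι-+ : ∀ a b → ι (a ℕ.+ b) ≡ ι a + ι b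
ι-+ ℕ.zero    b = sym (ℚP.+-identityˡ (ι b))
ι-+ (ℕ.suc a) b = trans (cong (1ℚ +_) (ι-+ a b)) (sym (ℚP.+-assoc 1ℚ (ι a) (ι b)))

ι-* : ∀ a b → ι (a ℕ.* b) ≡ ι a * ι b
ι-* ℕ.zero    b = sym (ℚP.*-zeroˡ (ι b))
ι-* (ℕ.suc a) b = begin
  ι (b ℕ.+ a ℕ.* b)  ≡⟨ ι-+ b (a ℕ.* b) ⟩
  ι b + ι (a ℕ.* b)  ≡⟨ cong (ι b +_) (ι-* a b) ⟩
  ι b + ι a * ι b    ≡⟨ solve 2 (λ x y → y :+ x :* y := (con 1ℚ :+ x) :* y) refl (ι a) (ι b) ⟩
  (1ℚ + ι a) * ι b   ∎
  where open ≡-Reasoning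

0<1 : 0ℚ < 1ℚ
0<1 = ℚP.positive⁻¹ 1ℚ

ι-nonNeg : ∀ k → 0ℚ ≤ ι k
ι-nonNeg ℕ.zero    = ℚP.≤-refl
ι-nonNeg (ℕ.suc k) = ℚP.+-mono-≤ (ℚP.<⇒≤ 0<1) (ι-nonNeg k)

ι-mono : ∀ {a b} → a ℕ.≤ b → ι a ≤ ι b
ι-mono {a} a≤b with ℕP.m≤n⇒∃[o]m+o≡n a≤b
... | o , refl = begin
  ι a          ≡⟨ sym (ℚP.+-identityʳ (ι a)) ⟩
  ι a + 0ℚ     ≤⟨ ℚP.+-monoʳ-≤ (ι a) (ι-nonNeg o) ⟩
  ι a + ι o    ≡⟨ sym (ι-+ a o) ⟩
  ι (a ℕ.+ o)  ∎
  where open ℚP.≤-Reasoning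

ι-pos : ∀ k → 0ℚ < ι (ℕ.suc k)
ι-pos k = ℚP.+-mono-<-≤ 0<1 (ι-nonNeg k)

ι-normal : ∀ k → ι k ≡ mkℚ (pos k) 0 (Coprimality.sym (1-coprimeTo k))
ι-normal ℕ.zero    = refl
ι-normal (ℕ.suc k) = ℚP.toℚᵘ-injective (ℚᵘP.≃-trans
    (ℚP.toℚᵘ-homo-+ 1ℚ (ι k))
    (subst (λ q → ℚ.toℚᵘ 1ℚ ℚᵘ.+ ℚ.toℚᵘ q ℚᵘ.≃ ℚ.toℚᵘ (mkℚ (pos (ℕ.suc k)) 0 (Coprimality.sym (1-coprimeTo (ℕ.suc k))))) (sym (ι-normal k)) (ℚᵘ.*≡* numerators)))
  where
  numerators : (pos 1 ℤ.* pos 1 ℤ.+ pos k ℤ.* pos 1) ℤ.* pos 1 ≡ pos (ℕ.suc k) ℤ.* (pos 1 ℤ.* pos 1)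
  numerators = ZS.solve 1 (λ x → (ZS.con (pos 1) ZS.:* ZS.con (pos 1) ZS.:+ x ZS.:* ZS.con (pos 1)) ZS.:* ZS.con (pos 1)
                                ZS.:= (ZS.con (pos 1) ZS.:+ x) ZS.:* (ZS.con (pos 1) ZS.:* ZS.con (pos 1))) refl (pos k)

avg-factor-inverse : ∀ j → (pos 1 / ℕ.suc j) * ι (ℕ.suc j) ≡ 1ℚ
avg-factor-inverse j rewrite ι-normal (ℕ.suc j)
                           | ℚP.normalize-coprime {1} {j} (1-coprimeTo (ℕ.suc j)) =
  ℚP.*-inverseˡ (mkℚ (pos (ℕ.suc j)) 0 (Coprimality.sym (1-coprimeTo (ℕ.suc j))))

<⇒≱ : ∀ {x y} → x < y → ¬ (y ≤ x)
<⇒≱ x<y y≤x = ℚP.<-irrefl refl (ℚP.<-≤-trans x<y y≤x)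

x-y≤x : ∀ x {y} → 0ℚ ≤ y → x - y ≤ x
x-y≤x x {y} 0≤y = ℚP.≤-trans (ℚP.+-monoʳ-≤ x (ℚP.neg-antimono-≤ 0≤y)) (ℚP.≤-reflexive (ℚP.+-identityʳ x))

x-y<x : ∀ x {y} → 0ℚ < y → x - y < x
x-y<x x {y} 0<y = ℚP.<-≤-trans (ℚP.+-monoʳ-< x (ℚP.neg-antimono-< 0<y)) (ℚP.≤-reflexive (ℚP.+-identityʳ x))

x≤x+y : ∀ x {y} → 0ℚ ≤ y → x ≤ x + y
x≤x+y x 0≤y = ℚP.≤-trans (ℚP.≤-reflexive (sym (ℚP.+-identityʳ x))) (ℚP.+-monoʳ-≤ x 0≤y)

rate-below : ∀ {X} d t → X ≤ (0ℚ - d) * t → t * d ≤ - X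
rate-below {X} d t X≤ = subst (_≤ - X) (solve 2 (λ t d → :- ((con 0ℚ :- d) :* t) := t :* d) refl t d) (ℚP.neg-antimono-≤ X≤)

0≤* : ∀ {x y} → 0ℚ ≤ x → 0ℚ ≤ y → 0ℚ ≤ x * y
0≤* {x} {y} 0≤x 0≤y = ℚP.nonNegative⁻¹ (x * y)
  {{ℚP.nonNeg*nonNeg⇒nonNeg x {{ℚ.nonNegative 0≤x}} y {{ℚ.nonNegative 0≤y}}}}

ι-unbounded : ∀ C → ∃[ K ] C < ι K
ι-unbounded C@(mkℚ (pos a) d _) =
  ℕ.suc a , subst (C <_) (sym (ι-normal (ℕ.suc a)))
    (ℚ.*<* (subst (ℤ._< pos (ℕ.suc d ℕ.+ a ℕ.* ℕ.suc d)) (sym (ℤP.*-identityʳ (pos a)))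
      (ℤ.+<+ (ℕ.s≤s (ℕP.≤-trans (ℕP.m≤m*n a (ℕ.suc d)) (ℕP.m≤n+m _ d))))))
ι-unbounded C@(mkℚ (negsuc a) d _) = 1 , subst (C <_) (sym (ι-normal 1)) (ℚ.*<* ℤ.-<+)

archimedean : ∀ C q → 0ℚ < q → ∃[ K ] ∀ K′ → K ℕ.≤ K′ → C < ι K′ * q
archimedean C q 0<q = K , λ K′ K≤K′ → begin-strict
    C                  ≡⟨ C≡ ⟩
    (C * 1/ q) * q     <⟨ ℚP.*-monoˡ-<-pos q C/q<K ⟩
    ι K * q            ≤⟨ ℚP.*-monoʳ-≤-nonNeg q (ι-mono K≤K′) ⟩
    ι K′ * q           ∎
  where
  open ℚP.≤-Reasoning
  instance
    q-positive : ℚ.Positive q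
    q-positive = ℚ.positive 0<q
    q-nonZero : ℚ.NonZero q
    q-nonZero = ℚ.>-nonZero 0<q
    q-nonNegative : ℚ.NonNegative q
    q-nonNegative = ℚP.pos⇒nonNeg q
  K : ℕ
  K = proj₁ (ι-unbounded (C * 1/ q))
  C/q<K : C * 1/ q < ι K
  C/q<K = proj₂ (ι-unbounded (C * 1/ q))
  C≡ : C ≡ (C * 1/ q) * q
  C≡ = sym (trans (ℚP.*-assoc C (1/ q) q) (trans (cong (C *_) (ℚP.*-inverseˡ q)) (ℚP.*-identityʳ C)))

∣∣-bounds : ∀ x → - ∣ x ∣ ≤ x × x ≤ ∣ x ∣
∣∣-bounds x@(mkℚ (pos a) d _) = ℚP.≤-trans (ℚP.neg-antimono-≤ 0≤x) 0≤x , ℚP.≤-refl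
  where
  0≤x : 0ℚ ≤ x
  0≤x = ℚP.nonNegative⁻¹ x
∣∣-bounds x@(mkℚ (negsuc a) d _) = ℚP.≤-refl , ℚP.≤-trans (ℚP.nonPositive⁻¹ x) (ℚP.nonNegative⁻¹ (- x))

upperBound : ∀ k (f : Fin k → ℚ) → ∃[ B ] (0ℚ ≤ B × ∀ i → f i ≤ B)
upperBound ℕ.zero    f = 0ℚ , ℚP.≤-refl , λ ()
upperBound (ℕ.suc k) f with upperBound k (λ i → f (Fin.suc i))
... | B , 0≤B , bound =
  f Fin.zero ⊔ B , ℚP.≤-trans 0≤B (ℚP.p≤q⊔p (f Fin.zero) B) ,
  λ { Fin.zero → ℚP.p≤p⊔q _ B ; (Fin.suc i) → ℚP.≤-trans (bound i) (ℚP.p≤q⊔p (f Fin.zero) B) }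

dec-true⁻¹ : ∀ {P : Set} (P? : Dec P) → does P? ≡ true → P
dec-true⁻¹ (yes p) _ = p

crossing : ∀ (P : ℕ → Set) → (∀ a → Dec (P a)) → P 0 → ∀ K → ¬ P K → ∃[ a ] P a × ¬ P (ℕ.suc a)
crossing P P? P0 ℕ.zero    ¬PK = ⊥-elim (¬PK P0)
crossing P P? P0 (ℕ.suc K) ¬PK with P? K
... | yes PK = K , PK , ¬PK
... | no ¬PK′ = crossing P P? P0 K ¬PK′

any-word? : ∀ {m} k (P : List (Fin m) → Set) → (∀ u → Dec (P u)) → Dec (∃[ u ] length u ℕ.≤ k × P u)
any-word? ℕ.zero P P? with P? []
... | yes P[] = yes ([] , ℕ.z≤n , P[])
... | no ¬P[] = no λ { ([] , _ , P[]) → ¬P[] P[] ; (_ ∷ _ , () , _) }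
any-word? (ℕ.suc k) P P? with P? [] | FinP.any? (λ σ → any-word? k (λ u → P (σ ∷ u)) (λ u → P? (σ ∷ u)))
... | yes P[] | _ = yes ([] , ℕ.z≤n , P[])
... | no _    | yes (σ , u , |u|≤k , Pσu) = yes (σ ∷ u , ℕ.s≤s |u|≤k , Pσu)
... | no ¬P[] | no ¬Pσu = no λ { ([] , _ , P[]) → ¬P[] P[] ; (σ ∷ u , ℕ.s≤s |u|≤k , Pσu) → ¬Pσu (σ , u , |u|≤k , Pσu) }

Eventually : (ℕ → Set) → Set
Eventually P = ∃[ i ] ∀ j → i ℕ.≤ j → P j

¬¬-eventually-all : ∀ k (R : Fin k → ℕ → Set) → (∀ p → ¬ ¬ Eventually (R p))
                  → ¬ ¬ Eventually (λ j → ∀ p → R p j)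
¬¬-eventually-all ℕ.zero    R ev never = never (0 , λ j _ ())
¬¬-eventually-all (ℕ.suc k) R ev never = ev Fin.zero λ { (i₀ , R₀) →
  ¬¬-eventually-all k (λ p → R (Fin.suc p)) (λ p → ev (Fin.suc p)) λ { (i , Rₛ) →
    never (i₀ ℕ.+ i , λ { j i₀+i≤j Fin.zero    → R₀ j (ℕP.≤-trans (ℕP.m≤m+n i₀ i) i₀+i≤j)
                        ; j i₀+i≤j (Fin.suc p) → Rₛ j (ℕP.≤-trans (ℕP.m≤n+m i i₀) i₀+i≤j) p }) } }

-- Infinite pigeonhole principle (double-negated, as it is classical): if f : ℕ → Fin k
-- takes values satisfying P infinitely often, then one such value is taken infinitely often.
infinite-pigeonhole : ∀ {k} (f : ℕ → Fin k) (P : Fin k → Set) → (∀ i → ∃[ j ] i ℕ.≤ j × P (f j))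
                    → ¬ ¬ (∃[ p ] P p × ∀ i → ¬ ¬ (∃[ j ] i ℕ.≤ j × f j ≡ p))
infinite-pigeonhole {k} f P often none =
  ¬¬-eventually-all k (λ p j → P p → f j ≡ p → ⊥) eventually-avoided λ { (i , avoided) →
    let (j , i≤j , Pfj) = often i in avoided j i≤j (f j) Pfj refl }
  where
  eventually-avoided : ∀ p → ¬ ¬ Eventually (λ j → P p → f j ≡ p → ⊥)
  eventually-avoided p not-ev = not-ev (0 , λ j _ Pp _ →
    none (p , Pp , λ i no-visit → not-ev (i , λ j′ i≤j′ _ fj′≡p → no-visit (j′ , i≤j′ , fj′≡p))))

seg : ∀ {m} → Word m → ℕ → ℕ → List (Fin m)
seg w a ℕ.zero    = []
seg w a (ℕ.suc k) = w a ∷ seg w (ℕ.suc a) k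

seg-length : ∀ {m} (w : Word m) a k → length (seg w a k) ≡ k
seg-length w a ℕ.zero    = refl
seg-length w a (ℕ.suc k) = cong ℕ.suc (seg-length w (ℕ.suc a) k)

pow : ∀ {X : Set} → ℕ → List X → List X
pow ℕ.zero    u = []
pow (ℕ.suc k) u = u ++ pow k u

pow-length : ∀ {X : Set} k (u : List X) → length (pow k u) ≡ k ℕ.* length u
pow-length ℕ.zero    u = refl
pow-length (ℕ.suc k) u = trans (LP.length-++ u) (cong (length u ℕ.+_) (pow-length k u))

take-+ : ∀ {X : Set} i k (u : List X) → take (i ℕ.+ k) u ≡ take i u ++ take k (drop i u)
take-+ ℕ.zero    k u       = refl
take-+ (ℕ.suc i) k []      = sym (LP.take-[] k)
take-+ (ℕ.suc i) k (x ∷ u) = cong (x ∷_) (take-+ i k u)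

module Paths {n m : ℕ} (A : DetWA n m) where
  open DetWA A

  δ* : Fin n → List (Fin m) → Fin n
  δ* x []      = x
  δ* x (σ ∷ u) = δ* (δ x σ) u

  ws : Fin n → List (Fin m) → ℚ
  ws x []      = 0ℚ
  ws x (σ ∷ u) = γ x σ + ws (δ x σ) u

  visits : Fin n → List (Fin m) → List (Fin n)
  visits x []      = []
  visits x (σ ∷ u) = x ∷ visits (δ x σ) u

  δ*-++ : ∀ x u v → δ* x (u ++ v) ≡ δ* (δ* x u) v
  δ*-++ x []      v = refl
  δ*-++ x (σ ∷ u) v = δ*-++ (δ x σ) u v

  ws-++ : ∀ x u v → ws x (u ++ v) ≡ ws x u + ws (δ* x u) v
  ws-++ x []      v = sym (ℚP.+-identityˡ (ws x v))
  ws-++ x (σ ∷ u) v = trans (cong (γ x σ +_) (ws-++ (δ x σ) u v))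
                            (sym (ℚP.+-assoc (γ x σ) (ws (δ x σ) u) _))

  visits-++ : ∀ x u v → visits x (u ++ v) ≡ visits x u ++ visits (δ* x u) v
  visits-++ x []      v = refl
  visits-++ x (σ ∷ u) v = cong (x ∷_) (visits-++ (δ x σ) u v)

  run-seg : ∀ w a k → run A w (a ℕ.+ k) ≡ δ* (run A w a) (seg w a k)
  run-seg w a ℕ.zero    = cong (run A w) (ℕP.+-identityʳ a)
  run-seg w a (ℕ.suc k) = trans (cong (run A w) (ℕP.+-suc a k)) (run-seg w (ℕ.suc a) k)

  psum-seg : ∀ w a k → psum A w (a ℕ.+ k) ≡ psum A w a + ws (run A w a) (seg w a k)
  psum-seg w a ℕ.zero    = trans (cong (psum A w) (ℕP.+-identityʳ a)) (sym (ℚP.+-identityʳ (psum A w a)))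
  psum-seg w a (ℕ.suc k) = begin
    psum A w (a ℕ.+ ℕ.suc k)                                   ≡⟨ cong (psum A w) (ℕP.+-suc a k) ⟩
    psum A w (ℕ.suc a ℕ.+ k)                                   ≡⟨ psum-seg w (ℕ.suc a) k ⟩
    (psum A w a + weight A w a) + ws (run A w (ℕ.suc a)) (seg w (ℕ.suc a) k)
      ≡⟨ ℚP.+-assoc (psum A w a) (weight A w a) (ws (run A w (ℕ.suc a)) (seg w (ℕ.suc a) k)) ⟩
    psum A w a + ws (run A w a) (seg w a (ℕ.suc k))            ∎
    where open ≡-Reasoning

  visits-seg : ∀ {p} (P : Fin n → Set p) w a k → (∀ i → i ℕ.< k → P (run A w (a ℕ.+ i)))
             → All P (visits (run A w a) (seg w a k))
  visits-seg P w a ℕ.zero    h = []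
  visits-seg P w a (ℕ.suc k) h =
    subst P (cong (run A w) (ℕP.+-identityʳ a)) (h 0 (ℕ.s≤s ℕ.z≤n)) ∷
    visits-seg P w (ℕ.suc a) k (λ i i<k → subst P (cong (run A w) (ℕP.+-suc a i)) (h (ℕ.suc i) (ℕ.s≤s i<k)))

  Reachable : Fin n → Set
  Reachable x = ∃[ v ] δ* qI v ≡ x

  run-reachable : ∀ w a → Reachable (run A w a)
  run-reachable w a = seg w 0 a , sym (run-seg w 0 a)

  B : ℚ
  B = proj₁ (upperBound n λ q → proj₁ (upperBound m λ σ → ∣ γ q σ ∣))

  0≤B : 0ℚ ≤ B
  0≤B = proj₁ (proj₂ (upperBound n λ q → proj₁ (upperBound m λ σ → ∣ γ q σ ∣)))

  ∣γ∣≤B : ∀ q σ → ∣ γ q σ ∣ ≤ B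
  ∣γ∣≤B q σ = ℚP.≤-trans (proj₂ (proj₂ (upperBound m λ σ → ∣ γ q σ ∣)) σ)
                         (proj₂ (proj₂ (upperBound n λ q → proj₁ (upperBound m λ σ → ∣ γ q σ ∣))) q)

  ∣ws∣≤ : ∀ x u → ∣ ws x u ∣ ≤ B * ι (length u)
  ∣ws∣≤ x []      = ℚP.≤-reflexive (sym (ℚP.*-zeroʳ B))
  ∣ws∣≤ x (σ ∷ u) = begin
    ∣ γ x σ + ws (δ x σ) u ∣             ≤⟨ ℚP.∣p+q∣≤∣p∣+∣q∣ (γ x σ) _ ⟩
    ∣ γ x σ ∣ + ∣ ws (δ x σ) u ∣         ≤⟨ ℚP.+-mono-≤ (∣γ∣≤B x σ) (∣ws∣≤ (δ x σ) u) ⟩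
    B + B * ι (length u)                 ≡⟨ solve 2 (λ b l → b :+ b :* l := b :* (con 1ℚ :+ l)) refl B (ι (length u)) ⟩
    B * ι (length (σ ∷ u))               ∎
    where open ℚP.≤-Reasoning

  ws≤ : ∀ x u → ws x u ≤ B * ι (length u)
  ws≤ x u = ℚP.≤-trans (proj₂ (∣∣-bounds (ws x u))) (∣ws∣≤ x u)

  ≤ws : ∀ x u → - (B * ι (length u)) ≤ ws x u
  ≤ws x u = ℚP.≤-trans (ℚP.neg-antimono-≤ (∣ws∣≤ x u)) (proj₁ (∣∣-bounds (ws x u)))

  record ShortCycle (x : Fin n) (u : List (Fin m)) : Set where
    field
      u₁ u₂ u₃ : List (Fin m)
      split    : u ≡ u₁ ++ u₂ ++ u₃
      nonempty : 1 ℕ.≤ length u₂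
      short    : length u₂ ℕ.≤ n
      cycle    : δ* (δ* x u₁) u₂ ≡ δ* x u₁

  -- Pigeonhole: among the n+1 prefixes of length ≤ n of a word longer than n,
  -- two lead from x to the same state; the factor between them is a short cycle.
  shortCycle : ∀ x u → n ℕ.< length u → ShortCycle x u
  shortCycle x u n<|u| with FinP.pigeonhole (ℕP.n<1+n n) (λ (i : Fin (ℕ.suc n)) → δ* x (take (Fin.toℕ i) u))
  ... | i , j , i<j , same = record
    { u₁ = take a u ; u₂ = take k rest ; u₃ = drop k rest
    ; split    = sym (trans (cong (take a u ++_) (LP.take++drop≡id k rest)) (LP.take++drop≡id a u))
    ; nonempty = subst (1 ℕ.≤_) (sym |u₂|≡k) (ℕP.m<n⇒0<n∸m a<b)
    ; short    = subst (ℕ._≤ n) (sym |u₂|≡k) (ℕP.≤-trans (ℕP.m∸n≤m b a) b≤n)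
    ; cycle    = begin
        δ* (δ* x (take a u)) (take k rest)   ≡⟨ sym (δ*-++ x (take a u) (take k rest)) ⟩
        δ* x (take a u ++ take k rest)       ≡⟨ cong (δ* x) (sym (take-+ a k u)) ⟩
        δ* x (take (a ℕ.+ k) u)              ≡⟨ cong (λ l → δ* x (take l u)) (ℕP.m+[n∸m]≡n (ℕP.<⇒≤ a<b)) ⟩
        δ* x (take b u)                      ≡⟨ sym same ⟩
        δ* x (take a u)                      ∎
    }
    where
    open ≡-Reasoning
    a b k : ℕ
    a = Fin.toℕ i
    b = Fin.toℕ j
    k = b ℕ.∸ a
    rest : List (Fin m)
    rest = drop a u
    a<b : a ℕ.< b
    a<b = FinP.toℕ-mono-< i<j
    b≤n : b ℕ.≤ n
    b≤n = ℕP.≤-pred (FinP.toℕ<n j)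
    |u₂|≡k : length (take k rest) ≡ k
    |u₂|≡k = trans (LP.length-take k rest) (ℕP.m≤n⇒m⊓n≡m (subst (k ℕ.≤_) (sym (LP.length-drop a u))
               (ℕP.∸-monoˡ-≤ a (ℕP.≤-trans b≤n (ℕP.<⇒≤ n<|u|)))))

  module CycleRemoval {x u} (c : ShortCycle x u) where
    open ShortCycle c

    cut : List (Fin m)
    cut = u₁ ++ u₃

    cut-shorter : length cut ℕ.< length u
    cut-shorter rewrite split | LP.length-++ u₁ {u₃} | LP.length-++ u₁ {u₂ ++ u₃} | LP.length-++ u₂ {u₃} =
      ℕP.+-monoʳ-< (length u₁) (ℕP.m<n+m (length u₃) nonempty)

    cut-δ* : δ* x cut ≡ δ* x u
    cut-δ* rewrite split = begin
      δ* x (u₁ ++ u₃)                   ≡⟨ δ*-++ x u₁ u₃ ⟩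
      δ* (δ* x u₁) u₃                   ≡⟨ cong (λ s → δ* s u₃) (sym cycle) ⟩
      δ* (δ* (δ* x u₁) u₂) u₃           ≡⟨ sym (δ*-++ (δ* x u₁) u₂ u₃) ⟩
      δ* (δ* x u₁) (u₂ ++ u₃)           ≡⟨ sym (δ*-++ x u₁ (u₂ ++ u₃)) ⟩
      δ* x (u₁ ++ u₂ ++ u₃)             ∎
      where open ≡-Reasoning

    cut-ws : ws x u ≡ ws x cut + ws (δ* x u₁) u₂
    cut-ws rewrite split = begin
      ws x (u₁ ++ u₂ ++ u₃)                              ≡⟨ ws-++ x u₁ (u₂ ++ u₃) ⟩
      ws x u₁ + ws s (u₂ ++ u₃)                          ≡⟨ cong (ws x u₁ +_) (ws-++ s u₂ u₃) ⟩
      ws x u₁ + (ws s u₂ + ws (δ* s u₂) u₃)              ≡⟨ cong (λ t → ws x u₁ + (ws s u₂ + ws t u₃)) cycle ⟩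
      ws x u₁ + (ws s u₂ + ws s u₃)                      ≡⟨ solve 3 (λ p q r → p :+ (q :+ r) := (p :+ r) :+ q) refl (ws x u₁) (ws s u₂) (ws s u₃) ⟩
      (ws x u₁ + ws s u₃) + ws s u₂                      ≡⟨ cong (_+ ws s u₂) (sym (ws-++ x u₁ u₃)) ⟩
      ws x (u₁ ++ u₃) + ws s u₂                          ∎
      where
      open ≡-Reasoning
      s : Fin n
      s = δ* x u₁

    cut-visits : ∀ {p} {P : Fin n → Set p} → All P (visits x u)
               → All P (visits x cut) × All P (visits (δ* x u₁) u₂)
    cut-visits {P = P} all rewrite split =
      subst (All P) (sym (visits-++ x u₁ u₃))
        (AllP.++⁺ (proj₁ all₁) (subst (λ s → All P (visits s u₃)) cycle (proj₂ all₂))) ,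
      proj₁ all₂
      where
      all₁ : All P (visits x u₁) × All P (visits (δ* x u₁) (u₂ ++ u₃))
      all₁ = AllP.++⁻ (visits x u₁) (subst (All P) (visits-++ x u₁ (u₂ ++ u₃)) all)
      all₂ : All P (visits (δ* x u₁) u₂) × All P (visits (δ* (δ* x u₁) u₂) u₃)
      all₂ = AllP.++⁻ (visits (δ* x u₁) u₂) (subst (All P) (visits-++ (δ* x u₁) u₂ u₃) (proj₂ all₁))

  shortcut : ∀ x u → ∃[ u′ ] length u′ ℕ.≤ n × δ* x u′ ≡ δ* x u
  shortcut x u = go u (<-wellFounded (length u))
    where
    go : ∀ u → Acc ℕ._<_ (length u) → ∃[ u′ ] length u′ ℕ.≤ n × δ* x u′ ≡ δ* x u
    go u (acc smaller) with length u ℕ.≤? n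
    ... | yes short = u , short , refl
    ... | no long =
      let open CycleRemoval (shortCycle x u (ℕP.≰⇒> long))
          (u′ , short , same) = go cut (smaller cut-shorter)
      in u′ , short , trans same cut-δ*

  module _ {p u} (cyc : δ* p u ≡ p) where
    pow-cycle : ∀ k → δ* p (pow k u) ≡ p
    pow-cycle ℕ.zero    = refl
    pow-cycle (ℕ.suc k) = trans (δ*-++ p u (pow k u)) (trans (cong (λ s → δ* s (pow k u)) cyc) (pow-cycle k))

    pow-ws : ∀ k → ws p (pow k u) ≡ ι k * ws p u
    pow-ws ℕ.zero    = sym (ℚP.*-zeroˡ (ws p u))
    pow-ws (ℕ.suc k) = begin
      ws p (u ++ pow k u)               ≡⟨ ws-++ p u (pow k u) ⟩
      ws p u + ws (δ* p u) (pow k u)    ≡⟨ cong (λ s → ws p u + ws s (pow k u)) cyc ⟩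
      ws p u + ws p (pow k u)           ≡⟨ cong (ws p u +_) (pow-ws k) ⟩
      ws p u + ι k * ws p u             ≡⟨ solve 2 (λ x t → x :+ t :* x := (con 1ℚ :+ t) :* x) refl (ws p u) (ι k) ⟩
      ι (ℕ.suc k) * ws p u              ∎
      where open ≡-Reasoning

seg-suc : ∀ {m} (w : Word m) a k → seg w (ℕ.suc a) k ≡ seg (λ i → w (ℕ.suc i)) a k
seg-suc w a ℕ.zero    = refl
seg-suc w a (ℕ.suc k) = cong (w (ℕ.suc a) ∷_) (seg-suc w (ℕ.suc a) k)

seg-lookup : ∀ {m} (w : Word m) a (u : List (Fin m))
           → (∀ (i : Fin (length u)) → w (a ℕ.+ Fin.toℕ i) ≡ lookup u i) → seg w a (length u) ≡ u
seg-lookup w a []      agree = refl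
seg-lookup w a (σ ∷ u) agree = cong₂ _∷_
  (trans (cong w (sym (ℕP.+-identityʳ a))) (agree Fin.zero))
  (seg-lookup w (ℕ.suc a) u (λ i → trans (cong w (sym (ℕP.+-suc a (Fin.toℕ i)))) (agree (Fin.suc i))))

prepend : ∀ {m} → List (Fin m) → Word m → Word m
prepend []      w i         = w i
prepend (σ ∷ v) w ℕ.zero    = σ
prepend (σ ∷ v) w (ℕ.suc i) = prepend v w i

prepend-prefix : ∀ {m} (v : List (Fin m)) w → seg (prepend v w) 0 (length v) ≡ v
prepend-prefix []      w = refl
prepend-prefix (σ ∷ v) w = cong (σ ∷_) (trans (seg-suc (prepend (σ ∷ v) w) 0 (length v)) (prepend-prefix v w))

prepend-suffix : ∀ {m} (v : List (Fin m)) w a k → seg (prepend v w) (length v ℕ.+ a) k ≡ seg w a k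
prepend-suffix []      w a k = refl
prepend-suffix (σ ∷ v) w a k = trans (seg-suc (prepend (σ ∷ v) w) (length v ℕ.+ a) k) (prepend-suffix v w a k)

periodic : ∀ {m} → Fin m → List (Fin m) → Word m
periodic σ u′ i = lookup (σ ∷ u′) (Fin.fromℕ< (m%n<n i (length (σ ∷ u′))))

periodic-period : ∀ {m} (σ : Fin m) u′ t →
                  seg (periodic σ u′) (t ℕ.* length (σ ∷ u′)) (length (σ ∷ u′)) ≡ σ ∷ u′
periodic-period σ u′ t = seg-lookup (periodic σ u′) (t ℕ.* L) (σ ∷ u′) λ i →
  cong (lookup (σ ∷ u′)) (trans (FinP.fromℕ<-cong _ _ (index≡ i) _ (FinP.toℕ<n i)) (FinP.fromℕ<-toℕ i (FinP.toℕ<n i)))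
  where
  L : ℕ
  L = length (σ ∷ u′)
  index≡ : ∀ (i : Fin L) → (t ℕ.* L ℕ.+ Fin.toℕ i) % L ≡ Fin.toℕ i
  index≡ i = trans (cong (_% L) (ℕP.+-comm (t ℕ.* L) (Fin.toℕ i)))
             (trans ([m+kn]%n≡m%n (Fin.toℕ i) t L) (m<n⇒m%n≡m (FinP.toℕ<n i)))

module Averages {n m : ℕ} (A : DetWA n m) where
  open DetWA A

  avg-psum : ∀ w j → avg A w j * ι (ℕ.suc j) ≡ psum A w (ℕ.suc j)
  avg-psum w j = begin
    ((ℤ.+ 1 / ℕ.suc j) * P) * ι (ℕ.suc j)   ≡⟨ solve 3 (λ a p l → (a :* p) :* l := (a :* l) :* p) refl (ℤ.+ 1 / ℕ.suc j) P (ι (ℕ.suc j)) ⟩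
    ((ℤ.+ 1 / ℕ.suc j) * ι (ℕ.suc j)) * P   ≡⟨ cong (_* P) (avg-factor-inverse j) ⟩
    1ℚ * P                                 ≡⟨ ℚP.*-identityˡ P ⟩
    P                                      ∎
    where
    open ≡-Reasoning
    P : ℚ
    P = psum A w (ℕ.suc j)

  ≤avg⇒ : ∀ w j c → c ≤ avg A w j → c * ι (ℕ.suc j) ≤ psum A w (ℕ.suc j)
  ≤avg⇒ w j c c≤avg = subst (c * ι (ℕ.suc j) ≤_) (avg-psum w j)
    (ℚP.*-monoʳ-≤-nonNeg (ι (ℕ.suc j)) {{ℚ.nonNegative (ι-nonNeg (ℕ.suc j))}} c≤avg)

  avg≤⇒ : ∀ w j c → avg A w j ≤ c → psum A w (ℕ.suc j) ≤ c * ι (ℕ.suc j)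
  avg≤⇒ w j c avg≤c = subst (_≤ c * ι (ℕ.suc j)) (avg-psum w j)
    (ℚP.*-monoʳ-≤-nonNeg (ι (ℕ.suc j)) {{ℚ.nonNegative (ι-nonNeg (ℕ.suc j))}} avg≤c)

  psum-above : ∀ w c N → (∀ j → N ℕ.≤ j → c ≤ avg A w j) → ∀ T → N ℕ.< T → c * ι T ≤ psum A w T
  psum-above w c N above (ℕ.suc j) (ℕ.s≤s N≤j) = ≤avg⇒ w j c (above j N≤j)

shift : ∀ {n m} → DetWA n m → ℚ → DetWA n m
shift A c = record { qI = DetWA.qI A ; δ = DetWA.δ A ; γ = λ q σ → DetWA.γ A q σ - c }

module Shift {n m : ℕ} (A : DetWA n m) (c : ℚ) where
  open DetWA A

  run-shift : ∀ w i → run (shift A c) w i ≡ run A w i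
  run-shift w ℕ.zero    = refl
  run-shift w (ℕ.suc i) = cong (λ q → δ q (w i)) (run-shift w i)

  psum-shift : ∀ w k → psum (shift A c) w k ≡ psum A w k - c * ι k
  psum-shift w ℕ.zero    = sym (trans (cong (λ x → 0ℚ - x) (ℚP.*-zeroʳ c)) (ℚP.+-inverseʳ 0ℚ))
  psum-shift w (ℕ.suc k) = begin
    psum (shift A c) w k + (γ (run (shift A c) w k) (w k) - c)  ≡⟨ cong₂ (λ p q → p + (γ q (w k) - c)) (psum-shift w k) (run-shift w k) ⟩
    (psum A w k - c * ι k) + (weight A w k - c)                 ≡⟨ solve 4 (λ p x c l → (p :- c :* l) :+ (x :- c) := (p :+ x) :- c :* (con 1ℚ :+ l)) refl (psum A w k) (weight A w k) c (ι k) ⟩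
    psum A w (ℕ.suc k) - c * ι (ℕ.suc k)                        ∎
    where open ≡-Reasoning

  avg-shift : ∀ w j → avg (shift A c) w j ≡ avg A w j - c
  avg-shift w j = begin
    a * psum (shift A c) w (ℕ.suc j)   ≡⟨ cong (a *_) (psum-shift w (ℕ.suc j)) ⟩
    a * (P - c * ι (ℕ.suc j))          ≡⟨ solve 4 (λ a p c l → a :* (p :- c :* l) := a :* p :- c :* (a :* l)) refl a P c (ι (ℕ.suc j)) ⟩
    a * P - c * (a * ι (ℕ.suc j))      ≡⟨ cong (λ x → a * P - c * x) (avg-factor-inverse j) ⟩
    a * P - c * 1ℚ                     ≡⟨ cong (λ x → a * P - x) (ℚP.*-identityʳ c) ⟩
    avg A w j - c                      ∎
    where
    open ≡-Reasoning
    a = ℤ.+ 1 / ℕ.suc j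
    P : ℚ
    P = psum A w (ℕ.suc j)

  LimAvg>-shift : ∀ w x → LimAvg> A w x → LimAvg> (shift A c) w (x - c)
  LimAvg>-shift w x (d , 0<d , N , above) = d , 0<d , N , λ j N≤j →
    subst₂ _≤_ (solve 3 (λ x d c → (x :+ d) :- c := (x :- c) :+ d) refl x d c) (sym (avg-shift w j))
      (ℚP.+-monoˡ-≤ (- c) (above j N≤j))

  LimAvg>-unshift : ∀ w x → LimAvg> (shift A c) w (x - c) → LimAvg> A w x
  LimAvg>-unshift w x (d , 0<d , N , above) = d , 0<d , N , λ j N≤j →
    subst₂ _≤_ (solve 3 (λ x d c → (x :- c) :+ d :+ c := x :+ d) refl x d c)
               (trans (cong (_+ c) (avg-shift w j)) (solve 2 (λ a c → a :- c :+ c := a) refl (avg A w j) c))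
      (ℚP.+-monoˡ-≤ c (above j N≤j))

  LimAvg<-shift : ∀ w x → LimAvg< A w x → LimAvg< (shift A c) w (x - c)
  LimAvg<-shift w x (d , 0<d , below) = d , 0<d , λ N →
    let (j , N≤j , avg≤) = below N in
    j , N≤j , subst₂ _≤_ (sym (avg-shift w j)) (solve 3 (λ x d c → (x :- d) :- c := (x :- c) :- d) refl x d c)
                (ℚP.+-monoˡ-≤ (- c) avg≤)

ωregular-resp : ∀ {m} {L L′ : Word m → Set} → (∀ w → (L w → L′ w) × (L′ w → L w)) → OmegaRegular L′ → OmegaRegular L
ωregular-resp L⇔L′ (B , correct) = B , λ w → proj₁ (correct w) ∘ proj₁ (L⇔L′ w) , proj₂ (L⇔L′ w) ∘ proj₂ (correct w)

module LimitAverages {n m : ℕ} (A : DetWA n m) (w : Word m) where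

  >⇒≥ : ∀ {c c′} → c ≤ c′ → LimAvg> A w c′ → LimAvg≥ A w c
  >⇒≥ {c} {c′} c≤c′ (d , 0<d , N , above) e 0<e = N , λ j N≤j → begin
    c - e     ≤⟨ x-y≤x c (ℚP.<⇒≤ 0<e) ⟩
    c         ≤⟨ c≤c′ ⟩
    c′        ≤⟨ x≤x+y c′ (ℚP.<⇒≤ 0<d) ⟩
    c′ + d    ≤⟨ above j N≤j ⟩
    avg A w j ∎
    where open ℚP.≤-Reasoning

  ≥⇒¬< : ∀ {c c′} → c′ < c → LimAvg≥ A w c → LimAvg< A w c′ → ⊥
  ≥⇒¬< {c} {c′} c′<c liminf (d , 0<d , below) = ℚP.<-irrefl refl (begin-strict
    c′              ≡⟨ solve 2 (λ c c′ → c′ := c :- (c :- c′)) refl c c′ ⟩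
    c - (c - c′)    ≤⟨ proj₂ (liminf (c - c′) 0<c-c′) j N≤j ⟩
    avg A w j       ≤⟨ avg≤ ⟩
    c′ - d          <⟨ x-y<x c′ 0<d ⟩
    c′              ∎)
    where
    open ℚP.≤-Reasoning
    0<c-c′ : 0ℚ < c - c′
    0<c-c′ = subst (_< c - c′) (ℚP.+-inverseʳ c′) (ℚP.+-monoˡ-< (- c′) c′<c)
    N j : ℕ
    N = proj₁ (liminf (c - c′) 0<c-c′)
    j = proj₁ (below N)
    N≤j : N ℕ.≤ j
    N≤j = proj₁ (proj₂ (below N))
    avg≤ : avg A w j ≤ c′ - d
    avg≤ = proj₂ (proj₂ (below N))

-- The core of the construction, for an automaton A and a gap g > 0 such that on every word
-- the averages either eventually stay above g or infinitely often fall below 0.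
-- (The theorem reduces to this case by shifting the weights by η - ε.)
module Core {n m : ℕ} (A : DetWA n m) (g : ℚ) (0<g : 0ℚ < g)
            (split : ∀ w → LimAvg> A w g ⊎ LimAvg< A w 0ℚ) where
  open DetWA A
  open Paths A
  open Averages A

  module Lasso (v : List (Fin m)) (σ : Fin m) (u′ : List (Fin m)) {p : Fin n}
               (reach : δ* qI v ≡ p) (cyc : δ* p (σ ∷ u′) ≡ p) where
    u : List (Fin m)
    u = σ ∷ u′
    L V : ℕ
    L = length u
    V = length v
    Sv Su : ℚ
    Sv = ws qI v
    Su = ws p u

    word : Word m
    word = prepend v (periodic σ u′)

    at-period : ∀ t → run A word (V ℕ.+ t ℕ.* L) ≡ p × psum A word (V ℕ.+ t ℕ.* L) ≡ Sv + ι t * Su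
    at-period ℕ.zero = subst (λ T → run A word T ≡ p × psum A word T ≡ Sv + 0ℚ * Su) (sym (ℕP.+-identityʳ V))
      ( trans (run-seg word 0 V) (trans (cong (δ* qI) (prepend-prefix v _)) reach)
      , trans (psum-seg word 0 V) (trans (cong (0ℚ +_) (cong (ws qI) (prepend-prefix v _)))
                                        (solve 2 (λ x y → con 0ℚ :+ x := x :+ con 0ℚ :* y) refl Sv Su)))
    at-period (ℕ.suc t) = subst (λ T → run A word T ≡ p × psum A word T ≡ Sv + ι (ℕ.suc t) * Su) (sym time≡)
      ( trans (run-seg word T L) (trans (cong₂ δ* run-T period) cyc)
      , trans (psum-seg word T L) (trans (cong₂ (λ P q → P + ws q (seg word T L)) psum-T run-T)
          (trans (cong (λ x → (Sv + ι t * Su) + ws p x) period)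
                 (solve 3 (λ x s y → (x :+ s :* y) :+ y := x :+ (con 1ℚ :+ s) :* y) refl Sv (ι t) Su))) )
      where
      T : ℕ
      T = V ℕ.+ t ℕ.* L
      run-T : run A word T ≡ p
      run-T = proj₁ (at-period t)
      psum-T : psum A word T ≡ Sv + ι t * Su
      psum-T = proj₂ (at-period t)
      period : seg word T L ≡ u
      period = trans (prepend-suffix v (periodic σ u′) (t ℕ.* L) L) (periodic-period σ u′ t)
      time≡ : V ℕ.+ ℕ.suc t ℕ.* L ≡ T ℕ.+ L
      time≡ = trans (cong (V ℕ.+_) (ℕP.+-comm L (t ℕ.* L))) (sym (ℕP.+-assoc V (t ℕ.* L) L))

    -- Averages eventually above g force the cycle average above g: otherwise the partial sums
    -- at the times T = V + t·L would satisfy T·d ≤ Sv for arbitrarily large T.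
    not-above : LimAvg> A word g → Su ≤ g * ι L → ⊥
    not-above (d , 0<d , N , above) Su≤gL = <⇒≱ (proj₂ (archimedean Sv d 0<d) T K≤T) Td≤Sv
      where
      open ℚP.≤-Reasoning
      K t T : ℕ
      K = proj₁ (archimedean Sv d 0<d)
      t = K ℕ.+ ℕ.suc N
      T = V ℕ.+ t ℕ.* L
      t≤T : t ℕ.≤ T
      t≤T = ℕP.≤-trans (ℕP.m≤m*n t L) (ℕP.m≤n+m (t ℕ.* L) V)
      K≤T : K ℕ.≤ T
      K≤T = ℕP.≤-trans (ℕP.m≤m+n K (ℕ.suc N)) t≤T
      Td≤Sv : ι T * d ≤ Sv
      Td≤Sv = begin
        ι T * d                                        ≡⟨ solve 3 (λ x g d → x :* d := (g :+ d) :* x :- g :* x) refl (ι T) g d ⟩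
        (g + d) * ι T - g * ι T                        ≤⟨ ℚP.+-monoˡ-≤ (- (g * ι T)) (psum-above word (g + d) N above T (ℕP.≤-trans (ℕP.m≤n+m (ℕ.suc N) K) t≤T)) ⟩
        psum A word T - g * ι T                        ≡⟨ cong₂ (λ P x → P - g * x) (proj₂ (at-period t)) (trans (ι-+ V (t ℕ.* L)) (cong (ι V +_) (ι-* t L))) ⟩
        (Sv + ι t * Su) - g * (ι V + ι t * ι L)        ≤⟨ ℚP.+-monoˡ-≤ _ (ℚP.+-monoʳ-≤ Sv (ℚP.*-monoˡ-≤-nonNeg (ι t) {{ℚ.nonNegative (ι-nonNeg t)}} Su≤gL)) ⟩
        (Sv + ι t * (g * ι L)) - g * (ι V + ι t * ι L) ≡⟨ solve 5 (λ s t g l v → (s :+ t :* (g :* l)) :- g :* (v :+ t :* l) := s :- g :* v) refl Sv (ι t) g (ι L) (ι V) ⟩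
        Sv - g * ι V                                   ≤⟨ x-y≤x Sv (0≤* (ℚP.<⇒≤ 0<g) (ι-nonNeg V)) ⟩
        Sv                                             ∎

    -- Averages infinitely often below 0 force the cycle weight below 0: otherwise, writing
    -- T = V + t·L + r with r < L, the partial sums satisfy T·d ≤ B·L - Sv for arbitrarily large T.
    not-below : LimAvg< A word 0ℚ → 0ℚ ≤ Su → ⊥
    not-below (d , 0<d , below) 0≤Su = <⇒≱ (proj₂ (archimedean C d 0<d) T K≤T) Td≤C
      where
      open ℚP.≤-Reasoning
      C : ℚ
      C = B * ι L - Sv
      K j T x t r T′ : ℕ
      K = proj₁ (archimedean C d 0<d)
      j = proj₁ (below (K ℕ.+ V))
      T = ℕ.suc j
      x = T ℕ.∸ V
      t = x DivMod./ L
      r = x % L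
      T′ = V ℕ.+ t ℕ.* L
      K+V≤j : K ℕ.+ V ℕ.≤ j
      K+V≤j = proj₁ (proj₂ (below (K ℕ.+ V)))
      K≤T : K ℕ.≤ T
      K≤T = ℕP.≤-trans (ℕP.m≤m+n K V) (ℕP.m≤n⇒m≤1+n K+V≤j)
      T≡ : T ≡ T′ ℕ.+ r
      T≡ = trans (sym (ℕP.m+[n∸m]≡n (ℕP.≤-trans (ℕP.m≤n+m V K) (ℕP.m≤n⇒m≤1+n K+V≤j))))
           (trans (cong (V ℕ.+_) (trans (DivMod.m≡m%n+[m/n]*n x L) (ℕP.+-comm r (t ℕ.* L))))
                  (sym (ℕP.+-assoc V (t ℕ.* L) r)))
      remainder : - (B * ι L) ≤ ws p (seg word T′ r)
      remainder = ℚP.≤-trans (ℚP.neg-antimono-≤ (ℚP.*-monoˡ-≤-nonNeg B {{ℚ.nonNegative 0≤B}} (ι-mono (ℕP.<⇒≤ (m%n<n x L)))))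
                             (subst (λ k → - (B * ι k) ≤ ws p (seg word T′ r)) (seg-length word T′ r) (≤ws p (seg word T′ r)))
      lower : Sv - B * ι L ≤ psum A word T
      lower = begin
        Sv - B * ι L                                        ≤⟨ ℚP.+-mono-≤ (x≤x+y Sv (0≤* (ι-nonNeg t) 0≤Su)) remainder ⟩
        (Sv + ι t * Su) + ws p (seg word T′ r)              ≡⟨ sym (cong₂ (λ P q → P + ws q (seg word T′ r)) (proj₂ (at-period t)) (proj₁ (at-period t))) ⟩
        psum A word T′ + ws (run A word T′) (seg word T′ r) ≡⟨ sym (psum-seg word T′ r) ⟩
        psum A word (T′ ℕ.+ r)                              ≡⟨ cong (psum A word) (sym T≡) ⟩
        psum A word T                                       ∎
      Td≤C : ι T * d ≤ C
      Td≤C = begin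
        ι T * d                   ≤⟨ rate-below d (ι T) (avg≤⇒ word j (0ℚ - d) (proj₂ (proj₂ (below (K ℕ.+ V))))) ⟩
        - psum A word T           ≤⟨ ℚP.neg-antimono-≤ lower ⟩
        - (Sv - B * ι L)          ≡⟨ solve 2 (λ s b → :- (s :- b) := b :- s) refl Sv (B * ι L) ⟩
        C                         ∎

  -- Cycle dichotomy: every non-empty cycle at a reachable state has average > g or
  -- negative weight, since an average in [0, g] would contradict `split` on its lasso word.
  cycle-dichotomy : ∀ {p} → Reachable p → ∀ u → 1 ℕ.≤ length u → δ* p u ≡ p
                  → g * ι (length u) < ws p u ⊎ ws p u < 0ℚ
  cycle-dichotomy {p} (v , reach) (σ ∷ u′) _ cyc with ws p (σ ∷ u′) ℚP.<? 0ℚ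
  ... | yes negative = inj₂ negative
  ... | no ¬negative with g * ι (length (σ ∷ u′)) ℚP.<? ws p (σ ∷ u′)
  ...   | yes high = inj₁ high
  ...   | no ¬high with split (Lasso.word v σ u′ reach cyc)
  ...     | inj₁ above = ⊥-elim (Lasso.not-above v σ u′ reach cyc above (ℚP.≮⇒≥ ¬high))
  ...     | inj₂ below = ⊥-elim (Lasso.not-below v σ u′ reach cyc below (ℚP.≮⇒≥ ¬negative))

  -- At a reachable state p there is no pair of cycles c, W with average(c) > g and ws(W) < 0.
  -- Otherwise fix b large; the cycles x a = c^a W^b have negative weight for a = 0 but not for
  -- large a, so at the first crossing the cycle x (a+1) has weight in [0, ws c), while its
  -- length ≥ b forces (by the dichotomy) a weight above g·b > ws c.
  no-mixed-cycles : ∀ {p} → Reachable p → ∀ c W → δ* p c ≡ p → δ* p W ≡ p → 1 ℕ.≤ length W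
                  → g * ι (length c) < ws p c → ws p W < 0ℚ → ⊥
  no-mixed-cycles {p} reach c W cyc-c cyc-W |W|≥1 high negative =
    [ crossing-high , ¬low-a+1 ]′ (cycle-dichotomy reach (x (ℕ.suc a)) (ℕP.≤-trans (ℕ.s≤s ℕ.z≤n) (b≤|x| (ℕ.suc a))) (x-cycle (ℕ.suc a)))
    where
    Sc Sw : ℚ
    Sc = ws p c
    Sw = ws p W
    0<Sc : 0ℚ < Sc
    0<Sc = ℚP.≤-<-trans (0≤* (ℚP.<⇒≤ 0<g) (ι-nonNeg (length c))) high
    b₀ b : ℕ
    b₀ = proj₁ (archimedean Sc g 0<g)
    b = ℕ.suc b₀
    Sc<bg : Sc < ι b * g
    Sc<bg = proj₂ (archimedean Sc g 0<g) b (ℕP.n≤1+n b₀)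

    x : ℕ → List (Fin m)
    x a = pow a c ++ pow b W

    x-cycle : ∀ a → δ* p (x a) ≡ p
    x-cycle a = trans (δ*-++ p (pow a c) (pow b W)) (trans (cong (λ s → δ* s (pow b W)) (pow-cycle {u = c} cyc-c a)) (pow-cycle {u = W} cyc-W b))

    x-ws : ∀ a → ws p (x a) ≡ ι a * Sc + ι b * Sw
    x-ws a = trans (ws-++ p (pow a c) (pow b W))
                   (cong₂ _+_ (pow-ws {u = c} cyc-c a) (trans (cong (λ s → ws s (pow b W)) (pow-cycle {u = c} cyc-c a)) (pow-ws {u = W} cyc-W b)))

    b≤|x| : ∀ a → b ℕ.≤ length (x a)
    b≤|x| a = subst (b ℕ.≤_) (sym (trans (LP.length-++ (pow a c)) (cong₂ ℕ._+_ (pow-length a c) (pow-length b W))))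
                (ℕP.≤-trans (ℕP.≤-trans (ℕP.≤-reflexive (sym (ℕP.*-identityʳ b))) (ℕP.*-monoʳ-≤ b |W|≥1))
                            (ℕP.m≤n+m (b ℕ.* length W) (a ℕ.* length c)))

    Low : ℕ → Set
    Low a = ws p (x a) < 0ℚ

    low-0 : Low 0
    low-0 = subst (_< 0ℚ) (sym (trans (x-ws 0) (solve 2 (λ s y → con 0ℚ :* s :+ y := y) refl Sc (ι b * Sw))))
              (ℚP.<-≤-trans (ℚP.*-monoʳ-<-pos (ι b) {{ℚ.positive (ι-pos b₀)}} negative) (ℚP.≤-reflexive (ℚP.*-zeroʳ (ι b))))

    K : ℕ
    K = proj₁ (archimedean (- (ι b * Sw)) Sc 0<Sc)

    ¬low-K : ¬ Low K
    ¬low-K low = ℚP.<-asym low (subst₂ _<_ (ℚP.+-inverseˡ (ι b * Sw)) (sym (x-ws K))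
                   (ℚP.+-monoˡ-< (ι b * Sw) (proj₂ (archimedean (- (ι b * Sw)) Sc 0<Sc) K ℕP.≤-refl)))

    crossing-point : ∃[ a ] Low a × ¬ Low (ℕ.suc a)
    crossing-point = crossing Low (λ a → ws p (x a) ℚP.<? 0ℚ) low-0 K ¬low-K
    a : ℕ
    a = proj₁ crossing-point
    low-a : Low a
    low-a = proj₁ (proj₂ crossing-point)
    ¬low-a+1 : ¬ Low (ℕ.suc a)
    ¬low-a+1 = proj₂ (proj₂ crossing-point)

    crossing-high : ¬ (g * ι (length (x (ℕ.suc a))) < ws p (x (ℕ.suc a)))
    crossing-high high′ = ℚP.<-irrefl refl (begin-strict
      g * ι |x|                  <⟨ high′ ⟩
      ws p (x (ℕ.suc a))         ≡⟨ trans (x-ws (ℕ.suc a)) (solve 4 (λ s t y z → (con 1ℚ :+ t) :* s :+ y :* z := s :+ (t :* s :+ y :* z)) refl Sc (ι a) (ι b) Sw) ⟩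
      Sc + (ι a * Sc + ι b * Sw) <⟨ ℚP.+-monoʳ-< Sc (subst (_< 0ℚ) (x-ws a) low-a) ⟩
      Sc + 0ℚ                    ≡⟨ ℚP.+-identityʳ Sc ⟩
      Sc                         <⟨ Sc<bg ⟩
      ι b * g                    ≤⟨ ℚP.≤-trans (ℚP.*-monoʳ-≤-nonNeg g {{ℚ.nonNegative (ℚP.<⇒≤ 0<g)}} (ι-mono (b≤|x| (ℕ.suc a)))) (ℚP.≤-reflexive (ℚP.*-comm (ι |x|) g)) ⟩
      g * ι |x|                  ∎)
      where
      open ℚP.≤-Reasoning
      |x| : ℕ
      |x| = length (x (ℕ.suc a))

  -- Goodness is decidable (there are finitely many candidate cycles); it is the acceptance
  -- condition of the Büchi automaton.
  GoodCycle : Fin n → List (Fin m) → Set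
  GoodCycle x u = 1 ℕ.≤ length u × δ* x u ≡ x × 0ℚ ≤ ws x u

  Good : Fin n → Set
  Good x = ∃[ u ] length u ℕ.≤ n × GoodCycle x u

  good? : ∀ x → Dec (Good x)
  good? x = any-word? n (GoodCycle x) λ u → (1 ℕ.≤? length u) ×-dec (δ* x u FinP.≟ x) ×-dec (0ℚ ℚP.≤? ws x u)

  -- At a reachable good state every cycle has non-negative weight: the good cycle itself
  -- has average > g by the dichotomy, so a negative cycle would contradict no-mixed-cycles.
  good⇒cycles-nonneg : ∀ {p} → Reachable p → Good p → ∀ W → δ* p W ≡ p → 0ℚ ≤ ws p W
  good⇒cycles-nonneg reach good [] _ = ℚP.≤-refl
  good⇒cycles-nonneg {p} reach (c , _ , |c|≥1 , cyc-c , 0≤Sc) W@(_ ∷ _) cyc-W with ws p W ℚP.<? 0ℚ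
  ... | no ¬negative = ℚP.≮⇒≥ ¬negative
  ... | yes negative = ⊥-elim ([ (λ high → no-mixed-cycles reach c W cyc-c cyc-W (ℕ.s≤s ℕ.z≤n) high negative)
                                , (λ negative-c → <⇒≱ negative-c 0≤Sc) ]′ (cycle-dichotomy reach c |c|≥1 cyc-c))

  ¬good⇒short-cycles-negative : ∀ {x u} → ¬ Good x → length u ℕ.≤ n → 1 ℕ.≤ length u → δ* x u ≡ x → ws x u < 0ℚ
  ¬good⇒short-cycles-negative {u = u} ¬good short nonempty cyc =
    ℚP.≰⇒> λ 0≤ws → ¬good (u , short , nonempty , cyc , 0≤ws)

  -- A path avoiding good states has weight at most B·n: short cycles at non-good states have
  -- negative weight and can be removed until the remaining path has length ≤ n.
  avoiding-good-bound : ∀ x u → All (λ q → ¬ Good q) (visits x u) → ws x u ≤ B * ι n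
  avoiding-good-bound x u avoid = go u avoid (<-wellFounded (length u))
    where
    first-visit : ∀ {P : Fin n → Set} {y} v → 1 ℕ.≤ length v → All P (visits y v) → P y
    first-visit (_ ∷ _) _ (Py ∷ _) = Py

    go : ∀ u → All (λ q → ¬ Good q) (visits x u) → Acc ℕ._<_ (length u) → ws x u ≤ B * ι n
    go u avoid (acc smaller) with length u ℕ.≤? n
    ... | yes short = ℚP.≤-trans (ws≤ x u) (ℚP.*-monoˡ-≤-nonNeg B {{ℚ.nonNegative 0≤B}} (ι-mono short))
    ... | no long = begin
        ws x u                     ≡⟨ cut-ws ⟩
        ws x cut + ws (δ* x u₁) u₂ ≤⟨ ℚP.+-mono-≤ (go cut (proj₁ (cut-visits avoid)) (smaller cut-shorter)) (ℚP.<⇒≤ negative) ⟩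
        B * ι n + 0ℚ               ≡⟨ ℚP.+-identityʳ (B * ι n) ⟩
        B * ι n                    ∎
      where
      open ℚP.≤-Reasoning
      removal : ShortCycle x u
      removal = shortCycle x u (ℕP.≰⇒> long)
      open ShortCycle removal
      open CycleRemoval removal
      negative : ws (δ* x u₁) u₂ < 0ℚ
      negative = ¬good⇒short-cycles-negative {δ* x u₁} {u₂} (first-visit u₂ nonempty (proj₂ (cut-visits avoid))) short nonempty cycle

  -- If the averages eventually stay above g, good states occur infinitely often in the run:
  -- after time i, a window of length K without good states would have weight ≤ B·n,
  -- too little for the growth (g + d)·T of the partial sums once K is large.
  above⇒good-often : ∀ w → LimAvg> A w g → ∀ i → ∃[ j ] i ℕ.≤ j × Good (run A w j)
  above⇒good-often w (d , 0<d , N , above) i = in-window (FinP.any? λ (k : Fin K) → good? (run A w (i ℕ.+ Fin.toℕ k)))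
    where
    0<g+d : 0ℚ < g + d
    0<g+d = ℚP.+-mono-< 0<g 0<d
    C : ℚ
    C = psum A w i + B * ι n
    K₀ K T : ℕ
    K₀ = proj₁ (archimedean C (g + d) 0<g+d)
    K = K₀ ℕ.+ ℕ.suc N
    T = i ℕ.+ K

    in-window : Dec (∃[ k ] Good (run A w (i ℕ.+ Fin.toℕ k))) → ∃[ j ] i ℕ.≤ j × Good (run A w j)
    in-window (yes (k , good)) = i ℕ.+ Fin.toℕ k , ℕP.m≤m+n i (Fin.toℕ k) , good
    in-window (no none) = ⊥-elim (ℚP.<-irrefl refl (begin-strict
      ι K * (g + d)                      ≤⟨ ℚP.*-monoʳ-≤-nonNeg (g + d) {{ℚ.nonNegative (ℚP.<⇒≤ 0<g+d)}} (ι-mono (ℕP.m≤n+m K i)) ⟩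
      ι T * (g + d)                      ≡⟨ ℚP.*-comm (ι T) (g + d) ⟩
      (g + d) * ι T                      ≤⟨ psum-above w (g + d) N above T (ℕP.≤-trans (ℕP.m≤n+m (ℕ.suc N) K₀) (ℕP.m≤n+m K i)) ⟩
      psum A w T                         ≡⟨ psum-seg w i K ⟩
      psum A w i + ws (run A w i) (seg w i K)  ≤⟨ ℚP.+-monoʳ-≤ (psum A w i) (avoiding-good-bound (run A w i) (seg w i K) avoid) ⟩
      C                                  <⟨ proj₂ (archimedean C (g + d) 0<g+d) K (ℕP.m≤m+n K₀ (ℕ.suc N)) ⟩
      ι K * (g + d)                      ∎))
      where
      open ℚP.≤-Reasoning
      avoid : All (λ q → ¬ Good q) (visits (run A w i) (seg w i K))
      avoid = visits-seg (λ q → ¬ Good q) w i K λ k k<K good →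
        none (Fin.fromℕ< k<K , subst (λ j → Good (run A w (i ℕ.+ j))) (sym (FinP.toℕ-fromℕ< k<K)) good)

  -- If the good state p is visited at times s₀ ≤ T ≤ t, the partial sums cannot have dropped
  -- by more than B·n between s₀ and T: the factor from s₀ to T followed by a path of length ≤ n
  -- back to p (shortening the factor from T to t) is a cycle at p, hence of non-negative weight.
  return-cycle-bound : ∀ w {p} → Good p → ∀ s₀ T t → s₀ ℕ.≤ T → T ℕ.≤ t → run A w s₀ ≡ p → run A w t ≡ p
                     → psum A w s₀ - B * ι n ≤ psum A w T
  return-cycle-bound w {p} good s₀ T t s₀≤T T≤t at-s₀ at-t = begin
    psum A w s₀ - B * ι n                                 ≤⟨ ℚP.+-monoʳ-≤ (psum A w s₀) (ℚP.neg-antimono-≤ (ℚP.*-monoˡ-≤-nonNeg B {{ℚ.nonNegative 0≤B}} (ι-mono |ret|≤n))) ⟩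
    psum A w s₀ - B * ι (length ret)                      ≤⟨ ℚP.+-monoʳ-≤ (psum A w s₀) (ℚP.neg-antimono-≤ (ws≤ (run A w T) ret)) ⟩
    psum A w s₀ - ws (run A w T) ret                      ≤⟨ x≤x+y (psum A w s₀ - ws (run A w T) ret) 0≤W ⟩
    psum A w s₀ - ws (run A w T) ret + ws p W             ≡⟨ cong (psum A w s₀ - ws (run A w T) ret +_) W-weight ⟩
    psum A w s₀ - ws (run A w T) ret + (ws p (seg w s₀ Δ) + ws (run A w T) ret)
                                                          ≡⟨ solve 3 (λ P r s → P :- r :+ (s :+ r) := P :+ s) refl (psum A w s₀) (ws (run A w T) ret) (ws p (seg w s₀ Δ)) ⟩
    psum A w s₀ + ws p (seg w s₀ Δ)                       ≡⟨ cong (λ q → psum A w s₀ + ws q (seg w s₀ Δ)) (sym at-s₀) ⟩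
    psum A w s₀ + ws (run A w s₀) (seg w s₀ Δ)            ≡⟨ sym (psum-seg w s₀ Δ) ⟩
    psum A w (s₀ ℕ.+ Δ)                                   ≡⟨ cong (psum A w) s₀+Δ≡T ⟩
    psum A w T                                            ∎
    where
    open ℚP.≤-Reasoning
    Δ : ℕ
    Δ = T ℕ.∸ s₀
    s₀+Δ≡T : s₀ ℕ.+ Δ ≡ T
    s₀+Δ≡T = ℕP.m+[n∸m]≡n s₀≤T
    ret : List (Fin m)
    ret = proj₁ (shortcut (run A w T) (seg w T (t ℕ.∸ T)))
    |ret|≤n : length ret ℕ.≤ n
    |ret|≤n = proj₁ (proj₂ (shortcut (run A w T) (seg w T (t ℕ.∸ T))))
    ret-end : δ* (run A w T) ret ≡ p
    ret-end = trans (proj₂ (proj₂ (shortcut (run A w T) (seg w T (t ℕ.∸ T)))))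
                    (trans (sym (run-seg w T (t ℕ.∸ T))) (trans (cong (run A w) (ℕP.m+[n∸m]≡n T≤t)) at-t))
    to-T : δ* p (seg w s₀ Δ) ≡ run A w T
    to-T = trans (cong (λ q → δ* q (seg w s₀ Δ)) (sym at-s₀)) (trans (sym (run-seg w s₀ Δ)) (cong (run A w) s₀+Δ≡T))
    W : List (Fin m)
    W = seg w s₀ Δ ++ ret
    W-cycle : δ* p W ≡ p
    W-cycle = trans (δ*-++ p (seg w s₀ Δ) ret) (trans (cong (λ q → δ* q ret) to-T) ret-end)
    W-weight : ws p W ≡ ws p (seg w s₀ Δ) + ws (run A w T) ret
    W-weight = trans (ws-++ p (seg w s₀ Δ) ret) (cong (λ q → ws p (seg w s₀ Δ) + ws q ret) to-T)
    0≤W : 0ℚ ≤ ws p W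
    0≤W = good⇒cycles-nonneg (subst Reachable at-s₀ (run-reachable w s₀)) good W W-cycle

  -- A good state visited infinitely often keeps the averages from falling below 0 infinitely
  -- often: by return-cycle-bound, psum T ≥ psum s₀ - B·n, whereas psum T ≤ -d·T for large T.
  good-recurrent⇒¬below : ∀ w p → Good p → (∀ i → ¬ ¬ (∃[ j ] i ℕ.≤ j × run A w j ≡ p))
                        → LimAvg< A w 0ℚ → ⊥
  good-recurrent⇒¬below w p good recurrent (d , 0<d , below) = recurrent 0 λ (s₀ , _ , at-s₀) → late-visit s₀ at-s₀
    where
    late-visit : ∀ s₀ → run A w s₀ ≡ p → ⊥
    late-visit s₀ at-s₀ = recurrent T λ (t , T≤t , at-t) → <⇒≱ (proj₂ (archimedean C d 0<d) T K≤T) (begin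
      ι T * d                     ≤⟨ rate-below d (ι T) (avg≤⇒ w j (0ℚ - d) (proj₂ (proj₂ (below (K ℕ.+ s₀))))) ⟩
      - psum A w T                ≤⟨ ℚP.neg-antimono-≤ (return-cycle-bound w good s₀ T t s₀≤T T≤t at-s₀ at-t) ⟩
      - (psum A w s₀ - B * ι n)   ≡⟨ solve 2 (λ s b → :- (s :- b) := b :- s) refl (psum A w s₀) (B * ι n) ⟩
      C                           ∎)
      where
      open ℚP.≤-Reasoning
      C : ℚ
      C = B * ι n - psum A w s₀
      K j T : ℕ
      K = proj₁ (archimedean C d 0<d)
      j = proj₁ (below (K ℕ.+ s₀))
      T = ℕ.suc j
      K+s₀≤j : K ℕ.+ s₀ ℕ.≤ j
      K+s₀≤j = proj₁ (proj₂ (below (K ℕ.+ s₀)))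
      K≤T : K ℕ.≤ T
      K≤T = ℕP.≤-trans (ℕP.m≤m+n K s₀) (ℕP.m≤n⇒m≤1+n K+s₀≤j)
      s₀≤T : s₀ ℕ.≤ T
      s₀≤T = ℕP.≤-trans (ℕP.m≤n+m s₀ K) (ℕP.m≤n⇒m≤1+n K+s₀≤j)

  -- Conversely, if good states occur infinitely often the averages eventually stay above g:
  -- by the infinite pigeonhole principle some good state recurs, which excludes the other
  -- alternative of `split`.
  good-often⇒above : ∀ w → (∀ i → ∃[ j ] i ℕ.≤ j × Good (run A w j)) → LimAvg> A w g
  good-often⇒above w often with split w
  ... | inj₁ above = above
  ... | inj₂ below = ⊥-elim (infinite-pigeonhole (run A w) Good often λ (p , good , recurrent) →
                               good-recurrent⇒¬below w p good recurrent below)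

  büchi : NBA m
  büchi = record { k = n ; init = qI ; Δ = λ q σ q′ → does (δ q σ FinP.≟ q′) ; acc = λ q → does (good? q) }

  büchi-run : ∀ w r → IsRun büchi w r → ∀ i → r i ≡ run A w i
  büchi-run w r (r₀ , step) ℕ.zero    = r₀
  büchi-run w r (r₀ , step) (ℕ.suc i) =
    trans (sym (dec-true⁻¹ (δ (r i) (w i) FinP.≟ r (ℕ.suc i)) (step i))) (cong (λ q → δ q (w i)) (büchi-run w r (r₀ , step) i))

  ωregular : OmegaRegular (λ w → LimAvg> A w g)
  ωregular = büchi , λ w → accept w , good-often⇒above w ∘ accepted⇒good-often w
    where
    accept : ∀ w → LimAvg> A w g → Accepts büchi w
    accept w lim = run A w , (refl , λ i → dec-true (δ (run A w i) (w i) FinP.≟ run A w (ℕ.suc i)) refl) ,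
                   λ i → let (j , i≤j , good) = above⇒good-often w lim i in j , i≤j , dec-true (good? (run A w j)) good
    accepted⇒good-often : ∀ w → Accepts büchi w → ∀ i → ∃[ j ] i ℕ.≤ j × Good (run A w j)
    accepted⇒good-often w (r , is-run , accepting) i =
      let (j , i≤j , acc-j) = accepting i
      in j , i≤j , dec-true⁻¹ (good? (run A w j)) (subst (λ q → does (good? q) ≡ true) (büchi-run w r is-run j) acc-j)

-- Let ε > 0 witness that η is isolated and shift all weights by c = η - ε. In the shifted
-- automaton the averages of every word eventually stay above g = (η + ε) - c = 2ε or
-- infinitely often fall below 0, so Core applies; and L(w) ≥ η holds exactly when the
-- shifted averages eventually stay above g.
theorem3p5 : ∀ {n m : ℕ} (A : DetWA n m) (η : ℚ) → IsolatedCutPoint A η → OmegaRegular (CutPointLang A η)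
theorem3p5 A η (ε , 0<ε , isolated) = ωregular-resp cut-point⇔above (Core.ωregular (shift A c) g 0<g split)
  where
  c g : ℚ
  c = η - ε
  g = (η + ε) - c
  open Shift A c

  0<g : 0ℚ < g
  0<g = subst (0ℚ <_) (solve 2 (λ η ε → ε :+ ε := (η :+ ε) :- (η :- ε)) refl η ε) (ℚP.+-mono-< 0<ε 0<ε)

  split : ∀ w → LimAvg> (shift A c) w g ⊎ LimAvg< (shift A c) w 0ℚ
  split w = Sum.map (LimAvg>-shift w (η + ε)) (subst (LimAvg< (shift A c) w) (ℚP.+-inverseʳ c) ∘ LimAvg<-shift w c) (isolated w)

  cut-point⇔above : ∀ w → (CutPointLang A η w → LimAvg> (shift A c) w g) × (LimAvg> (shift A c) w g → CutPointLang A η w)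
  cut-point⇔above w =
    [ (λ above _ → LimAvg>-shift w (η + ε) above)
    , (λ below ≥η → ⊥-elim (≥⇒¬< (x-y<x η 0<ε) ≥η below)) ]′ (isolated w) ,
    λ above → >⇒≥ (x≤x+y η (ℚP.<⇒≤ 0<ε)) (LimAvg>-unshift w (η + ε) above)
    where open LimitAverages A w
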